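{- There exists an infinite family of cubic bipartite graphs $G$ of girth $6$ such that $\chi_M(G^2) > \chi(G^2)+1$.
   Context: All graphs are simple. For a graph $G$, the square $G^2$ is the graph on $V(G)$ in which two distinct vertices are adjacent if and only if their distance in $G$ is at most $2$. $\chi(H)$ denotes the chromatic number of $H$. The Mirzakhani-chromatic number $\chi_M(H)$ is the minimum integer $k$ such that for every function $c_0: V(H)\to \mathbb{Z}$ there is a proper coloring $c: V(H)\to\{1,\dots,k\}$ with $c(v)\neq c_0(v)$ for every vertex $v$. -}

module Defs where

open import Data.Bool using (Bool; true; false; if_then_else_)
open import Data.Nat using (ℕ; zero; suc; _≤_; _<_; _+_)
open import Data.Fin using (Fin; toℕ; inject₁; fromℕ) renaming (zero to fz; suc to fs)
open import Data.List using (List; map; allFin)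
open import Data.Nat.ListAction using (sum)
open import Data.Integer using (ℤ; +_)
open import Data.Product using (Σ; _×_; ∃)
open import Data.Sum using (_⊎_)
open import Data.Empty using (⊥)
open import Relation.Nullary using (¬_)
open import Relation.Binary.PropositionalEquality using (_≡_; _≢_)
open import Function.Definitions using (Injective)

record Graph (n : ℕ) : Set where
  field
    Adj    : Fin n → Fin n → Bool
    sym    : ∀ u v → Adj u v ≡ Adj v u
    irrefl : ∀ v → Adj v v ≡ false
open Graph public

_~_within_ : {n : ℕ} → Fin n → Fin n → Graph n → Set
u ~ v within G = Adj G u v ≡ true

degree : {n : ℕ} → Graph n → Fin n → ℕ
degree {n} G v = sum (map (λ w → if Adj G v w then 1 else 0) (allFin n))

Cubic : {n : ℕ} → Graph n → Set
Cubic G = ∀ v → degree G v ≡ 3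

Bipartite : {n : ℕ} → Graph n → Set
Bipartite {n} G = Σ (Fin n → Bool) λ side → ∀ u v → u ~ v within G → side u ≢ side v

HasCycle : {n : ℕ} → Graph n → ℕ → Set
HasCycle G zero = ⊥
HasCycle {n} G (suc m) =
  Σ (Fin (suc m) → Fin n) λ c →
    Injective _≡_ _≡_ c
    × (∀ (i : Fin m) → c (inject₁ i) ~ c (fs i) within G)
    × (c (fromℕ m) ~ c fz within G)

HasGirth : {n : ℕ} → Graph n → ℕ → Set
HasGirth G g = 3 ≤ g × HasCycle G g × (∀ k → 3 ≤ k → k < g → ¬ HasCycle G k)

SqAdj : {n : ℕ} → Graph n → Fin n → Fin n → Set
SqAdj {n} G u v = u ≢ v × (u ~ v within G ⊎ ∃ λ (w : Fin n) → (u ~ w within G) × (w ~ v within G))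

-- A proper colouring of the graph with adjacency relation R using colours Fin k
-- (colour i : Fin k stands for the integer toℕ i + 1 ∈ {1,…,k}).
ProperColouring : {n : ℕ} → (Fin n → Fin n → Set) → (k : ℕ) → (Fin n → Fin k) → Set
ProperColouring R k c = ∀ u v → R u v → c u ≢ c v

Colourable : {n : ℕ} → (Fin n → Fin n → Set) → ℕ → Set
Colourable {n} R k = Σ (Fin n → Fin k) (ProperColouring R k)

colourValue : {k : ℕ} → Fin k → ℤ
colourValue i = + (suc (toℕ i))

MColourable : {n : ℕ} → (Fin n → Fin n → Set) → ℕ → Set
MColourable {n} R k = (c₀ : Fin n → ℤ) →
  Σ (Fin n → Fin k) λ c → ProperColouring R k c × (∀ v → colourValue (c v) ≢ c₀ v)

IsMinimum : (ℕ → Set) → ℕ → Set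
IsMinimum P k = P k × (∀ j → P j → k ≤ j)

IsChromaticNumber : {n : ℕ} → (Fin n → Fin n → Set) → ℕ → Set
IsChromaticNumber R = IsMinimum (Colourable R)

IsMirzakhaniChromaticNumber : {n : ℕ} → (Fin n → Fin n → Set) → ℕ → Set
IsMirzakhaniChromaticNumber R = IsMinimum (MColourable R)

-- The Möbius–Kantor graph GP(8,3) is cubic, bipartite and has girth 6. In its square a vertex and its
-- three neighbours form a K₄, and there is a proper 4-colouring with four vertices per class, so χ = 4.
-- Such small classes leave enough room to dodge any c₀ with six colours, while five colours fail for one
-- explicit c₀, by exhaustive search. All these properties survive disjoint unions of copies, which gives
-- the infinite family.

module Submission where

open import Defs
open import Data.Nat using (ℕ; _≤_; _<_; _+_)
open import Data.Product using (Σ; _×_; ∃)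

open import Data.Bool using (Bool; true; false; T; _∧_; _∨_; if_then_else_)
import Data.Bool.Properties as Bool
open import Data.Bool.Properties using (∧-zeroʳ; ¬-not)
open import Data.Bool.ListAction using (all)
open import Data.Empty using (⊥; ⊥-elim)
import Data.Fin as Fin
open import Data.Fin using (Fin; zero; suc; #_; toℕ; inject₁; inject≤; fromℕ; punchIn; _↑ˡ_; _↑ʳ_; combine;
  quotient; remainder; _≟_)
open import Data.Fin.Patterns using (0F; 1F; 2F; 3F; 4F; 5F)
open import Data.Fin.Permutation as Perm using (Permutation; _⟨$⟩ʳ_; _⟨$⟩ˡ_; insert)
open import Data.Fin.Properties using (all?; any?; pigeonhole; <⇒≢; toℕ-injective; toℕ-inject≤;
  inject≤-injective; punchIn-injective; remQuot-combine; combine-remQuot; combine-injectiveʳ)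
open import Data.Integer using (ℤ)
import Data.Integer as ℤ
import Data.Integer.Properties as ℤ using (+-injective)
open import Data.List using (List; []; _∷_; allFin; tabulate)
open import Data.List.Membership.Propositional.Properties using (∈-allFin)
open import Data.List.Properties using (map-tabulate)
open import Data.List.Relation.Unary.All as All using (All; []; _∷_)
open import Data.List.Relation.Unary.All.Properties using (all⁺)
open import Data.Nat using (zero; suc; _*_; _<ᵇ_; _≡ᵇ_; _%_; _/_; z≤n; s≤s)
import Data.Nat.Properties as ℕ
open import Data.Nat.DivMod using (_mod_)
open import Data.Nat.ListAction using (sum)
open import Data.Nat.Properties using (+-assoc; +-identityʳ; m+n≮m; ≰⇒>; n<1+n; m<n⇒m<1+n; suc-injective)
open import Data.Product using (∃₂; _,_; proj₁; proj₂; map₂)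
open import Data.Sum using (_⊎_; inj₁; inj₂; [_,_]′)
open import Data.Vec using ([]; _∷_; lookup)
open import Function using (_∘_; case_of_)
open import Function.Definitions using (Injective)
open import Relation.Nullary using (Dec; yes; no; does; ¬_; contradiction)
open import Relation.Nullary.Decidable using (¬?; _×-dec_; _⊎-dec_; _→-dec_; dec-true; decidable-stable;
  from-yes)
open import Relation.Unary using (Decidable)
open import Relation.Binary.PropositionalEquality using (_≡_; _≢_; refl; subst; trans; cong; cong₂;
  module ≡-Reasoning)
import Relation.Binary.PropositionalEquality as ≡

private variable
  k l m n : ℕ
  R : Fin n → Fin n → Set

∑ : (Fin n → ℕ) → ℕ
∑ f = sum (tabulate f)

∑-cong : {f g : Fin n → ℕ} → (∀ i → f i ≡ g i) → ∑ f ≡ ∑ g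
∑-cong {zero}  eq = refl
∑-cong {suc n} eq = cong₂ _+_ (eq zero) (∑-cong (eq ∘ suc))

∑-zero : ∑ {n} (λ _ → 0) ≡ 0
∑-zero {zero}  = refl
∑-zero {suc n} = ∑-zero {n}

∑-point : (i : Fin n) (x : ℕ) → ∑ (λ j → if does (i ≟ j) then x else 0) ≡ x
∑-point {suc n} zero    x = trans (cong (x +_) (∑-zero {n})) (+-identityʳ x)
∑-point {suc n} (suc i) x = ∑-point i x

∑-↑ : (f : Fin (m + n) → ℕ) → ∑ f ≡ ∑ (f ∘ (_↑ˡ n)) + ∑ (f ∘ (m ↑ʳ_))
∑-↑ {zero}  f = refl
∑-↑ {suc m} {n} f = trans (cong (f zero +_) (∑-↑ {m} {n} (f ∘ suc))) (≡.sym (+-assoc (f zero) _ _))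

∑-combine : (f : Fin (m * n) → ℕ) → ∑ f ≡ ∑ {m} λ b → ∑ {n} λ a → f (combine b a)
∑-combine {zero}      f = refl
∑-combine {suc m} {n} f =
  trans (∑-↑ {n} {m * n} f) (cong (∑ (f ∘ (_↑ˡ (m * n))) +_) (∑-combine {m} {n} (f ∘ (n ↑ʳ_))))

degree-∑ : (G : Graph n) (v : Fin n) → degree G v ≡ ∑ λ w → if Adj G v w then 1 else 0
degree-∑ G v = cong sum (map-tabulate (λ w → w) (λ w → if Adj G v w then 1 else 0))

Steps : {A : Set} → (A → A → Set) → (Fin (suc m) → A) → Set
Steps {m} R c = ∀ (i : Fin m) → R (c (inject₁ i)) (c (suc i))

steps-≡ : {A : Set} (f : Fin (suc m) → A) → Steps _≡_ f → ∀ i → f i ≡ f zero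
steps-≡         f steps zero    = refl
steps-≡ {suc m} f steps (suc i) = trans (steps-≡ (f ∘ suc) (steps ∘ suc) i) (≡.sym (steps zero))

steps-≢-even : ∀ j (s : Fin (suc (j * 2)) → Bool) → Steps _≢_ s → s (fromℕ (j * 2)) ≡ s zero
steps-≢-even zero    s steps = refl
steps-≢-even (suc j) s steps =
  trans (steps-≢-even j (λ i → s (suc (suc i))) (λ i → steps (suc (suc i)))) twoSteps
  where
  twoSteps : s (suc (suc zero)) ≡ s zero
  twoSteps = trans (¬-not (steps (suc zero) ∘ ≡.sym)) (≡.sym (¬-not (steps zero)))

~-sym : (G : Graph n) {u v : Fin n} → u ~ v within G → v ~ u within G
~-sym G {u} {v} e = trans (Graph.sym G v u) e

adj? : (G : Graph n) → ∀ u v → Dec (u ~ v within G)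
adj? G u v = Adj G u v Bool.≟ true

SqAdj? : (G : Graph n) → ∀ u v → Dec (SqAdj G u v)
SqAdj? G u v = ¬? (u ≟ v) ×-dec (adj? G u v ⊎-dec any? λ w → adj? G u w ×-dec adj? G w v)

bipartite⇒¬oddCycle : (G : Graph n) → Bipartite G → ∀ j → ¬ HasCycle G (suc (j * 2))
bipartite⇒¬oddCycle G (side , alternates) j (c , _ , path , closing) =
  alternates _ _ closing (steps-≢-even j (side ∘ c) (λ i → alternates _ _ (path i)))

C4Free : Graph n → Set
C4Free {n} G = ∀ (x y z w : Fin n) →
  x ~ y within G → y ~ z within G → x ~ w within G → w ~ z within G → x ≢ z → y ≡ w

C4Free⇒¬4-cycle : (G : Graph n) → C4Free G → ¬ HasCycle G 4
C4Free⇒¬4-cycle G free (c , injective , path , closing) =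
  case injective (free _ _ _ _ (path 0F) (path 1F) (~-sym G closing) (~-sym G (path 2F))
                       (λ c₀≡c₂ → case injective c₀≡c₂ of λ ())) of λ ()

girth-6 : (G : Graph n) → Bipartite G → C4Free G → HasCycle G 6 → HasGirth G 6
girth-6 G bipartite free hexagon = s≤s (s≤s (s≤s z≤n)) , hexagon , noShorter
  where
  noShorter : ∀ k → 3 ≤ k → k < 6 → ¬ HasCycle G k
  noShorter 0 () _
  noShorter 1 (s≤s ()) _
  noShorter 2 (s≤s (s≤s ())) _
  noShorter 3 _ _ = bipartite⇒¬oddCycle G bipartite 1
  noShorter 4 _ _ = C4Free⇒¬4-cycle G free
  noShorter 5 _ _ = bipartite⇒¬oddCycle G bipartite 2
  noShorter (suc (suc (suc (suc (suc (suc k)))))) _ k<6 = contradiction k<6 (m+n≮m 6 k)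

IsMinimum-⇔ : {P Q : ℕ → Set} → (∀ k → P k → Q k) → (∀ k → Q k → P k) →
              ∀ {k} → IsMinimum P k → IsMinimum Q k
IsMinimum-⇔ P⇒Q Q⇒P (Pk , least) = P⇒Q _ Pk , λ j Qj → least j (Q⇒P j Qj)

minimum-of-monotone : {P : ℕ → Set} → (∀ {i j} → i ≤ j → P i → P j) →
                      P (suc k) → ¬ P k → IsMinimum P (suc k)
minimum-of-monotone mono Psk ¬Pk = Psk , λ j Pj → ≰⇒> λ j≤k → ¬Pk (mono j≤k Pj)

colourValue-injective : {i j : Fin k} → colourValue i ≡ colourValue j → i ≡ j
colourValue-injective = toℕ-injective ∘ suc-injective ∘ ℤ.+-injective

colourValue-inject≤ : (i : Fin k) (k≤l : k ≤ l) → colourValue (inject≤ i k≤l) ≡ colourValue i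
colourValue-inject≤ i k≤l = cong (ℤ.+_ ∘ suc) (toℕ-inject≤ i k≤l)

colourable-mono : k ≤ l → Colourable R k → Colourable R l
colourable-mono k≤l (c , proper) =
  (λ v → inject≤ (c v) k≤l) , λ u v r → proper u v r ∘ inject≤-injective k≤l k≤l _ _

mColourable-mono : k ≤ l → MColourable R k → MColourable R l
mColourable-mono k≤l mc c₀ with mc c₀
... | c , proper , avoids =
  (λ v → inject≤ (c v) k≤l) ,
  (λ u v r → proper u v r ∘ inject≤-injective k≤l k≤l _ _) ,
  (λ v → avoids v ∘ trans (≡.sym (colourValue-inject≤ (c v) k≤l)))

clique⇒¬colourable : (q : Fin (suc k) → Fin n) → (∀ i j → i ≢ j → R (q i) (q j)) → ¬ Colourable R k
clique⇒¬colourable {k} q clique (c , proper) with pigeonhole (n<1+n k) (c ∘ q)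
... | i , j , i<j , same = proper _ _ (clique i j (<⇒≢ i<j)) same

-- If every colour of g is taken by c₀ on S, pigeonhole sends two colours to the same slot of S.
unusedColour : {S : Fin n → Set} → Decidable S → (slot : Fin n → Fin k) →
  (∀ {u v} → S u → S v → slot u ≡ slot v → u ≡ v) →
  (g : Fin l → Fin m) → Injective _≡_ _≡_ g → k < l →
  (c₀ : Fin n → ℤ) → ∃ λ j → ∀ v → S v → colourValue (g j) ≢ c₀ v
unusedColour {l = l} {S = S} S? slot slotInjective g gInjective k<l c₀ =
  map₂ (λ free v Sv same → free (v , Sv , same)) (decidable-stable (any? (¬? ∘ taken?)) someFree)
  where
  Taken : Fin l → Set
  Taken j = ∃ λ v → S v × colourValue (g j) ≡ c₀ v
  taken? : ∀ j → Dec (Taken j)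
  taken? j = any? λ v → S? v ×-dec (colourValue (g j) ℤ.≟ c₀ v)
  someFree : ¬ ¬ ∃ (¬_ ∘ Taken)
  someFree noneFree = collision (pigeonhole k<l (slot ∘ proj₁ ∘ taken))
    where
    taken : ∀ j → Taken j
    taken j = decidable-stable (taken? j) λ notTaken → noneFree (j , notTaken)
    inS : ∀ j → S (proj₁ (taken j))
    inS j = proj₁ (proj₂ (taken j))
    collision : ∃₂ (λ i j → i Fin.< j × slot (proj₁ (taken i)) ≡ slot (proj₁ (taken j))) → ⊥
    collision (i , j , i<j , sameSlot) = <⇒≢ i<j (gInjective (colourValue-injective (begin
      colourValue (g i)     ≡⟨ proj₂ (proj₂ (taken i)) ⟩
      c₀ (proj₁ (taken i))  ≡⟨ cong c₀ (slotInjective (inS i) (inS j) sameSlot) ⟩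
      c₀ (proj₁ (taken j))  ≡⟨ ≡.sym (proj₂ (proj₂ (taken j))) ⟩
      colourValue (g j)     ∎)))
      where open ≡-Reasoning

avoiding : {A : Set} → (A → Fin k) → A → A → ℤ → A
avoiding p a b z = if does (colourValue (p a) ℤ.≟ z) then b else a

avoiding-either : {A : Set} (p : A → Fin k) (a b : A) (z : ℤ) →
                  avoiding p a b z ≡ a ⊎ avoiding p a b z ≡ b
avoiding-either p a b z with does (colourValue (p a) ℤ.≟ z)
... | true  = inj₂ refl
... | false = inj₁ refl

avoiding-avoids : {A : Set} (p : A → Fin k) → Injective _≡_ _≡_ p →
  ∀ a b z → a ≢ b → colourValue (p (avoiding p a b z)) ≢ z
avoiding-avoids p pInjective a b z a≢b with colourValue (p a) ℤ.≟ z
... | yes taken = λ alsoTaken → a≢b (pInjective (colourValue-injective (trans taken (≡.sym alsoTaken))))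
... | no free   = free

-- Classes 0 and 1 have at most 4 vertices, so each gets a single colour avoiding c₀ on the whole
-- class; classes 2 and 3 get two of the remaining four colours each, and every vertex of them takes
-- the colour of its pair that c₀ does not forbid.
mColourable-6 : (class slot : Fin n → Fin 4) → ProperColouring R 4 class →
  (∀ {u v} → class u ≡ class v → slot u ≡ slot v → u ≡ v) → MColourable R 6
mColourable-6 {n} {R} class slot proper small c₀ = colour , colour-proper , colour-avoids
  where
  unused : (c : Fin 4) {l : ℕ} (g : Fin l → Fin 6) → Injective _≡_ _≡_ g → 4 < l →
           ∃ λ j → ∀ v → class v ≡ c → colourValue (g j) ≢ c₀ v
  unused c g gInjective 4<l =
    unusedColour (λ v → class v ≟ c) slot (λ u∈c v∈c → small (trans u∈c (≡.sym v∈c))) g gInjective 4<l c₀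

  first : ∃ λ j → ∀ v → class v ≡ zero → colourValue j ≢ c₀ v
  first = unused zero (λ i → i) (λ same → same) (m<n⇒m<1+n (n<1+n 4))

  second : ∃ λ j → ∀ v → class v ≡ suc zero → colourValue (punchIn (proj₁ first) j) ≢ c₀ v
  second = unused (suc zero) (punchIn (proj₁ first)) (punchIn-injective (proj₁ first) _ _) (n<1+n 4)

  -- Sends 0 to the first chosen colour and 1 to the second; slots 2, …, 5 hold the other four colours.
  palette : Permutation 6 6
  palette = insert zero (proj₁ first) (insert zero (proj₁ second) Perm.id)

  palette-injective : Injective _≡_ _≡_ (palette ⟨$⟩ʳ_)
  palette-injective {i} {j} same =
    trans (≡.sym (Perm.inverseˡ palette)) (trans (cong (palette ⟨$⟩ˡ_) same) (Perm.inverseˡ palette))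

  position : Fin 4 → ℤ → Fin 6
  position 0F z = 0F
  position 1F z = 1F
  position 2F z = avoiding (palette ⟨$⟩ʳ_) 2F 3F z
  position 3F z = avoiding (palette ⟨$⟩ʳ_) 4F 5F z

  classOf : Fin 6 → Fin 4
  classOf 0F = 0F
  classOf 1F = 1F
  classOf 2F = 2F
  classOf 3F = 2F
  classOf 4F = 3F
  classOf 5F = 3F

  classOf-position : ∀ c z → classOf (position c z) ≡ c
  classOf-position 0F z = refl
  classOf-position 1F z = refl
  classOf-position 2F z = [ cong classOf , cong classOf ]′ (avoiding-either (palette ⟨$⟩ʳ_) 2F 3F z)
  classOf-position 3F z = [ cong classOf , cong classOf ]′ (avoiding-either (palette ⟨$⟩ʳ_) 4F 5F z)

  colour : Fin n → Fin 6
  colour v = palette ⟨$⟩ʳ position (class v) (c₀ v)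

  colour-proper : ProperColouring R 6 colour
  colour-proper u v r same = proper u v r (begin
    class u                                 ≡⟨ ≡.sym (classOf-position (class u) (c₀ u)) ⟩
    classOf (position (class u) (c₀ u))     ≡⟨ cong classOf (palette-injective same) ⟩
    classOf (position (class v) (c₀ v))     ≡⟨ classOf-position (class v) (c₀ v) ⟩
    class v                                 ∎)
    where open ≡-Reasoning

  -- The class is an argument, not abstracted by with, so that Agda never normalises the chosen colours.
  avoids : ∀ c v → class v ≡ c → colourValue (palette ⟨$⟩ʳ position c (c₀ v)) ≢ c₀ v
  avoids 0F v v∈c = proj₂ first v v∈c
  avoids 1F v v∈c = proj₂ second v v∈c
  avoids 2F v _   = avoiding-avoids (palette ⟨$⟩ʳ_) palette-injective 2F 3F (c₀ v) λ ()
  avoids 3F v _   = avoiding-avoids (palette ⟨$⟩ʳ_) palette-injective 4F 5F (c₀ v) λ ()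

  colour-avoids : ∀ v → colourValue (colour v) ≢ c₀ v
  colour-avoids v = avoids (class v) v refl

-- Refuting colourings by exhaustive search

module Refutation {n k : ℕ} {R : Fin n → Fin n → Set} (R? : ∀ u v → Dec (R u v)) (forbidden : Fin n → Fin k)
  where

  Assignment : Set
  Assignment = List (Fin n × Fin k)

  Admissible : Assignment → Fin n → Fin k → Set
  Admissible assigned v c = c ≢ forbidden v × All (λ (u , cu) → R v u → c ≢ cu) assigned

  admissible? : ∀ assigned v c → Dec (Admissible assigned v c)
  admissible? assigned v c =
    ¬? (c ≟ forbidden v) ×-dec All.all? (λ (u , cu) → R? v u →-dec ¬? (c ≟ cu)) assigned

  refutes : List (Fin n) → Assignment → Bool
  refutes []       assigned = false
  refutes (v ∷ vs) assigned =
    all (λ c → if does (admissible? assigned v c) then refutes vs ((v , c) ∷ assigned) else true) (allFin k)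

  module _ (c : Fin n → Fin k) (proper : ProperColouring R k c) (avoids : ∀ v → c v ≢ forbidden v) where

    refutes-sound : ∀ vs assigned → All (λ (u , cu) → c u ≡ cu) assigned → ¬ T (refutes vs assigned)
    refutes-sound (v ∷ vs) assigned agrees refuted =
      extend (admissible? assigned v (c v)) (All.lookup (all⁺ _ (allFin k) refuted) (∈-allFin (c v)))
      where
      extend : (d : Dec (Admissible assigned v (c v))) →
               ¬ T (if does d then refutes vs ((v , c v) ∷ assigned) else true)
      extend (yes _)            = refutes-sound vs _ (refl ∷ agrees)
      extend (no inadmissible) _ =
        inadmissible (avoids v , All.map (λ cu≡ r same → proper v _ r (trans same (≡.sym cu≡))) agrees)

-- Disjoint copies

does-≟-sym : (a b : Fin n) → does (a ≟ b) ≡ does (b ≟ a)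
does-≟-sym a b with a ≟ b | b ≟ a
... | yes _   | yes _   = refl
... | no _    | no _    = refl
... | yes a≡b | no b≢a  = ⊥-elim (b≢a (≡.sym a≡b))
... | no a≢b  | yes b≡a = ⊥-elim (a≢b (≡.sym b≡a))

module _ {n : ℕ} (m : ℕ) where

  private
    block : Fin (m * n) → Fin m
    block = quotient n
    cell : Fin (m * n) → Fin n
    cell = remainder {m} n

  copies : Graph n → Graph (m * n)
  copies G = record
    { Adj    = λ x y → does (block x ≟ block y) ∧ Adj G (cell x) (cell y)
    ; sym    = λ x y → cong₂ _∧_ (does-≟-sym (block x) (block y)) (Graph.sym G (cell x) (cell y))
    ; irrefl = λ x → trans (cong (does (block x ≟ block x) ∧_) (irrefl G (cell x))) (∧-zeroʳ _)
    }

  block-cell-injective : ∀ {x y} → block x ≡ block y → cell x ≡ cell y → x ≡ y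
  block-cell-injective {x} {y} q r = begin
    x                          ≡⟨ ≡.sym (combine-remQuot {m} n x) ⟩
    combine (block x) (cell x) ≡⟨ cong₂ combine q r ⟩
    combine (block y) (cell y) ≡⟨ combine-remQuot {m} n y ⟩
    y                          ∎
    where open ≡-Reasoning

  block-combine : ∀ b a → block (combine b a) ≡ b
  block-combine b a = cong proj₁ (remQuot-combine {m} {n} b a)

  cell-combine : ∀ b a → cell (combine b a) ≡ a
  cell-combine b a = cong proj₂ (remQuot-combine {m} {n} b a)

  module _ (G : Graph n) where

    degree-copies : ∀ x → degree (copies G) x ≡ degree G (cell x)
    degree-copies x = begin
      degree (copies G) x
        ≡⟨ degree-∑ (copies G) x ⟩
      ∑ (λ y → indicator (Adj (copies G) x y))
        ≡⟨ ∑-combine {m} {n} _ ⟩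
      ∑ {m} (λ b → ∑ λ a → indicator (Adj (copies G) x (combine b a)))
        ≡⟨ ∑-cong inBlock ⟩
      ∑ {m} (λ b → if does (block x ≟ b) then degree G (cell x) else 0)
        ≡⟨ ∑-point (block x) _ ⟩
      degree G (cell x) ∎
      where
      open ≡-Reasoning
      indicator : Bool → ℕ
      indicator β = if β then 1 else 0
      inBlock : ∀ b → ∑ (λ a → indicator (Adj (copies G) x (combine b a)))
                    ≡ (if does (block x ≟ b) then degree G (cell x) else 0)
      inBlock b = trans (∑-cong λ a → cong indicator (cong₂ (λ b′ a′ → does (block x ≟ b′) ∧ Adj G (cell x) a′)
                                                        (block-combine b a) (cell-combine b a)))
                        (sameBlock? (block x ≟ b))
        where
        sameBlock? : (d : Dec (block x ≡ b)) →
          ∑ (λ a → indicator (does d ∧ Adj G (cell x) a)) ≡ (if does d then degree G (cell x) else 0)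
        sameBlock? (yes _) = ≡.sym (degree-∑ G (cell x))
        sameBlock? (no _)  = ∑-zero {n}

    ~-copies⁻ : ∀ {x y} → x ~ y within copies G → block x ≡ block y × cell x ~ cell y within G
    ~-copies⁻ {x} {y} = split (block x ≟ block y)
      where
      split : (d : Dec (block x ≡ block y)) → does d ∧ Adj G (cell x) (cell y) ≡ true →
              block x ≡ block y × cell x ~ cell y within G
      split (yes same) e = same , e

    ~-copies⁺ : ∀ b {a a′} → a ~ a′ within G → combine b a ~ combine b a′ within copies G
    ~-copies⁺ b {a} {a′} e = begin
      does (block (combine b a) ≟ block (combine b a′)) ∧ Adj G (cell (combine b a)) (cell (combine b a′))
        ≡⟨ cong₂ _∧_ (dec-true (block (combine b a) ≟ _)
                               (trans (block-combine b a) (≡.sym (block-combine b a′))))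
                     (cong₂ (Adj G) (cell-combine b a) (cell-combine b a′)) ⟩
      true ∧ Adj G a a′
        ≡⟨ e ⟩
      true ∎
      where open ≡-Reasoning

    sq-copies⁻ : ∀ {x y} → SqAdj (copies G) x y → block x ≡ block y × SqAdj G (cell x) (cell y)
    sq-copies⁻ (x≢y , inj₁ e) with ~-copies⁻ e
    ... | same , e′ = same , (x≢y ∘ block-cell-injective same) , inj₁ e′
    sq-copies⁻ (x≢y , inj₂ (w , e₁ , e₂)) with ~-copies⁻ e₁ | ~-copies⁻ e₂
    ... | same₁ , e₁′ | same₂ , e₂′ =
      let same = trans same₁ same₂ in same , (x≢y ∘ block-cell-injective same) , inj₂ (cell w , e₁′ , e₂′)

    sq-copies⁺ : ∀ b {a a′} → SqAdj G a a′ → SqAdj (copies G) (combine b a) (combine b a′)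
    sq-copies⁺ b (a≢a′ , inj₁ e) =
      (a≢a′ ∘ combine-injectiveʳ b _ b _) , inj₁ (~-copies⁺ b e)
    sq-copies⁺ b (a≢a′ , inj₂ (w , e₁ , e₂)) =
      (a≢a′ ∘ combine-injectiveʳ b _ b _) , inj₂ (combine b w , ~-copies⁺ b e₁ , ~-copies⁺ b e₂)

    cubic-copies : Cubic G → Cubic (copies G)
    cubic-copies cubic x = trans (degree-copies x) (cubic (cell x))

    bipartite-copies : Bipartite G → Bipartite (copies G)
    bipartite-copies (side , alternates) = side ∘ cell , λ u v e → alternates _ _ (proj₂ (~-copies⁻ e))

    cycle-copies⁻ : ∀ k → HasCycle (copies G) k → HasCycle G k
    cycle-copies⁻ (suc k) (c , injective , path , closing) =
      cell ∘ c , cell-injective , proj₂ ∘ ~-copies⁻ ∘ path , proj₂ (~-copies⁻ closing)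
      where
      sameBlock : ∀ i → block (c i) ≡ block (c zero)
      sameBlock = steps-≡ (block ∘ c) (proj₁ ∘ ~-copies⁻ ∘ path)
      cell-injective : Injective _≡_ _≡_ (cell ∘ c)
      cell-injective {i} {j} e = injective (block-cell-injective (trans (sameBlock i) (≡.sym (sameBlock j))) e)

    cycle-copies⁺ : Fin m → ∀ k → HasCycle G k → HasCycle (copies G) k
    cycle-copies⁺ b (suc k) (c , injective , path , closing) =
      combine b ∘ c , injective ∘ combine-injectiveʳ b _ b _ , ~-copies⁺ b ∘ path , ~-copies⁺ b closing

    girth-copies : Fin m → ∀ {g} → HasGirth G g → HasGirth (copies G) g
    girth-copies b {g} (3≤g , cycle , noShorter) =
      3≤g , cycle-copies⁺ b g cycle , λ k 3≤k k<g → noShorter k 3≤k k<g ∘ cycle-copies⁻ k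

    colourable-copies⁺ : ∀ {k} → Colourable (SqAdj G) k → Colourable (SqAdj (copies G)) k
    colourable-copies⁺ (c , proper) = c ∘ cell , λ u v sq → proper _ _ (proj₂ (sq-copies⁻ sq))

    colourable-copies⁻ : Fin m → ∀ {k} → Colourable (SqAdj (copies G)) k → Colourable (SqAdj G) k
    colourable-copies⁻ b (c , proper) = c ∘ combine b , λ a a′ sq → proper _ _ (sq-copies⁺ b sq)

    mColourable-copies⁺ : ∀ {k} → MColourable (SqAdj G) k → MColourable (SqAdj (copies G)) k
    mColourable-copies⁺ {k} mc c₀ = colour , proper , avoids
      where
      local : ∀ b → Σ (Fin n → Fin k) λ c →
                ProperColouring (SqAdj G) k c × ∀ a → colourValue (c a) ≢ c₀ (combine b a)
      local b = mc (c₀ ∘ combine b)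
      colour : Fin (m * n) → Fin k
      colour x = proj₁ (local (block x)) (cell x)
      proper : ProperColouring (SqAdj (copies G)) k colour
      proper u v sq same with sq-copies⁻ sq
      ... | sameBlock , sq′ =
        proj₁ (proj₂ (local (block u))) _ _ sq′
              (trans same (cong (λ b → proj₁ (local b) (cell v)) (≡.sym sameBlock)))
      avoids : ∀ x → colourValue (colour x) ≢ c₀ x
      avoids x = subst (λ y → colourValue (colour x) ≢ c₀ y) (combine-remQuot {m} n x)
                       (proj₂ (proj₂ (local (block x))) (cell x))

    mColourable-copies⁻ : Fin m → ∀ {k} → MColourable (SqAdj (copies G)) k → MColourable (SqAdj G) k
    mColourable-copies⁻ b mc c₀ with mc (c₀ ∘ cell)
    ... | c , proper , avoids =
      c ∘ combine b , (λ a a′ sq → proper _ _ (sq-copies⁺ b sq)) ,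
      λ a → subst (λ a′ → colourValue (c (combine b a)) ≢ c₀ a′) (cell-combine b a) (avoids (combine b a))

    chromaticNumber-copies : Fin m → ∀ {χ} →
                             IsChromaticNumber (SqAdj G) χ → IsChromaticNumber (SqAdj (copies G)) χ
    chromaticNumber-copies b = IsMinimum-⇔ (λ _ → colourable-copies⁺) (λ _ → colourable-copies⁻ b)

    mirzakhaniChromaticNumber-copies : Fin m → ∀ {χ} → IsMirzakhaniChromaticNumber (SqAdj G) χ →
                                       IsMirzakhaniChromaticNumber (SqAdj (copies G)) χ
    mirzakhaniChromaticNumber-copies b = IsMinimum-⇔ (λ _ → mColourable-copies⁺) (λ _ → mColourable-copies⁻ b)

-- The Möbius–Kantor graph

-- GP(8,3): outer vertices 0,…,7 and inner vertices 8,…,15, with edges i — i+1 and 8+i — 8+(i+3)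
-- (indices mod 8) and spokes i — 8+i; arc u v lists each edge once, from u.
arc : ℕ → ℕ → Bool
arc u v = if u <ᵇ 8 then (v ≡ᵇ suc u % 8) ∨ (v ≡ᵇ u + 8) else v ≡ᵇ 8 + (u + 3) % 8

möbiusKantorAdj : Fin 16 → Fin 16 → Bool
möbiusKantorAdj u v = arc (toℕ u) (toℕ v) ∨ arc (toℕ v) (toℕ u)

möbiusKantor : Graph 16
möbiusKantor = record
  { Adj    = möbiusKantorAdj
  ; sym    = λ u v → Bool.∨-comm (arc (toℕ u) (toℕ v)) (arc (toℕ v) (toℕ u))
  ; irrefl = from-yes (all? λ v → möbiusKantorAdj v v Bool.≟ false)
  }

private
  _~?_ : ∀ u v → Dec (u ~ v within möbiusKantor)
  _~?_ = adj? möbiusKantor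

möbiusKantor-cubic : Cubic möbiusKantor
möbiusKantor-cubic = from-yes (all? λ v → degree möbiusKantor v ℕ.≟ 3)

möbiusKantor-bipartite : Bipartite möbiusKantor
möbiusKantor-bipartite = side , from-yes (all? λ u → all? λ v → u ~? v →-dec ¬? (side u Bool.≟ side v))
  where
  side : Fin 16 → Bool
  side v = (toℕ v / 8 + toℕ v) % 2 ≡ᵇ 0

möbiusKantor-C4Free : C4Free möbiusKantor
möbiusKantor-C4Free = from-yes (all? λ x → all? λ y → all? λ z → all? λ w →
  x ~? y →-dec y ~? z →-dec x ~? w →-dec w ~? z →-dec ¬? (x ≟ z) →-dec y ≟ w)

möbiusKantor-hexagon : HasCycle möbiusKantor 6
möbiusKantor-hexagon =
  hexagon , injective , from-yes (all? λ i → hexagon (inject₁ i) ~? hexagon (suc i)) , refl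
  where
  hexagon : Fin 6 → Fin 16
  hexagon = lookup (# 0 ∷ # 1 ∷ # 2 ∷ # 3 ∷ # 11 ∷ # 8 ∷ [])
  injective : Injective _≡_ _≡_ hexagon
  injective {i} {j} = from-yes (all? λ i → all? λ j → hexagon i ≟ hexagon j →-dec i ≟ j) i j

möbiusKantor-girth : HasGirth möbiusKantor 6
möbiusKantor-girth = girth-6 möbiusKantor möbiusKantor-bipartite möbiusKantor-C4Free möbiusKantor-hexagon

squareColouring : Fin 16 → Fin 4
squareColouring v = (toℕ v + 2 * (toℕ v / 8)) mod 4

squareColouring-proper : ProperColouring (SqAdj möbiusKantor) 4 squareColouring
squareColouring-proper = from-yes (all? λ u → all? λ v →
  SqAdj? möbiusKantor u v →-dec ¬? (squareColouring u ≟ squareColouring v))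

row : Fin 16 → Fin 4
row = quotient {4} 4

squareColouring-classes : ∀ {u v} → squareColouring u ≡ squareColouring v → row u ≡ row v → u ≡ v
squareColouring-classes {u} {v} = from-yes (all? λ u → all? λ v →
  squareColouring u ≟ squareColouring v →-dec row u ≟ row v →-dec u ≟ v) u v

-- Vertex 0 and its three neighbours.
clique : Fin 4 → Fin 16
clique = lookup (# 0 ∷ # 1 ∷ # 7 ∷ # 8 ∷ [])

clique-square : ∀ i j → i ≢ j → SqAdj möbiusKantor (clique i) (clique j)
clique-square = from-yes (all? λ i → all? λ j → ¬? (i ≟ j) →-dec SqAdj? möbiusKantor (clique i) (clique j))

square-¬colourable-3 : ¬ Colourable (SqAdj möbiusKantor) 3
square-¬colourable-3 = clique⇒¬colourable clique clique-square

-- Found by computer search.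
forbidden : Fin 16 → Fin 5
forbidden = lookup (# 1 ∷ # 2 ∷ # 1 ∷ # 1 ∷ # 1 ∷ # 4 ∷ # 1 ∷ # 4 ∷
                    # 4 ∷ # 1 ∷ # 4 ∷ # 1 ∷ # 2 ∷ # 2 ∷ # 2 ∷ # 1 ∷ [])

square-¬mColourable-5 : ¬ MColourable (SqAdj möbiusKantor) 5
square-¬mColourable-5 mc with mc (colourValue ∘ forbidden)
... | c , proper , avoids =
  Refutation.refutes-sound (SqAdj? möbiusKantor) forbidden c proper (λ v → avoids v ∘ cong colourValue)
                           order [] [] _
  where
  -- Vertex 0 and its neighbours first: they form a clique in the square, which prunes the search early.
  order : List (Fin 16)
  order = # 0 ∷ # 1 ∷ # 7 ∷ # 8 ∷ # 2 ∷ # 6 ∷ # 9 ∷ # 15 ∷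
          # 3 ∷ # 4 ∷ # 5 ∷ # 10 ∷ # 11 ∷ # 12 ∷ # 13 ∷ # 14 ∷ []

square-chromaticNumber : IsChromaticNumber (SqAdj möbiusKantor) 4
square-chromaticNumber =
  minimum-of-monotone colourable-mono (squareColouring , squareColouring-proper) square-¬colourable-3

square-mirzakhaniChromaticNumber : IsMirzakhaniChromaticNumber (SqAdj möbiusKantor) 6
square-mirzakhaniChromaticNumber = minimum-of-monotone mColourable-mono
  (mColourable-6 squareColouring row squareColouring-proper squareColouring-classes) square-¬mColourable-5

mainTheorem1 : (N : ℕ) → Σ ℕ λ n → N ≤ n × Σ (Graph n) λ G →
    Cubic G × Bipartite G × HasGirth G 6 ×
    Σ ℕ λ χ → Σ ℕ λ χM →
      IsChromaticNumber (SqAdj G) χ × IsMirzakhaniChromaticNumber (SqAdj G) χM × χ + 1 < χM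
mainTheorem1 N =
  suc N * 16 , ℕ.≤-trans (ℕ.n≤1+n N) (ℕ.m≤m*n (suc N) 16) , copies (suc N) möbiusKantor ,
  cubic-copies (suc N) möbiusKantor möbiusKantor-cubic ,
  bipartite-copies (suc N) möbiusKantor möbiusKantor-bipartite ,
  girth-copies (suc N) möbiusKantor zero möbiusKantor-girth ,
  4 , 6 ,
  chromaticNumber-copies (suc N) möbiusKantor zero square-chromaticNumber ,
  mirzakhaniChromaticNumber-copies (suc N) möbiusKantor zero square-mirzakhaniChromaticNumber ,
  ℕ.≤-refl
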